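{- Let $k$ be a positive integer and let $r$ be an integer with $0\leq r\leq 4^k$ and $r\neq 4^k-1$. Then there is a decomposition of $\overrightarrow{C}_{(4^k:3)}$ into $r$ $\overrightarrow{C}_3$-factors and $s=4^k-r$ $\overrightarrow{C}_{3\cdot 2^k}$-factors.
   Context: $\overrightarrow{C}_{(4^k:3)}$ is the directed graph with three parts $G_0,G_1,G_2$, each of size $4^k$, with an arc from every vertex of $G_i$ to every vertex of $G_{i+1}$ (indices mod 3). A $\overrightarrow{C}_\ell$-factor is a spanning subgraph that is a vertex-disjoint union of directed cycles of length $\ell$; a decomposition is a partition of the arc set into spanning subgraphs. -}

module Defs where

open import Data.Nat using (ℕ; zero; suc; _<_; _≤_; _*_; _^_)
open import Data.Fin using (Fin; zero; suc; toℕ)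
open import Data.Product using (Σ; _×_; _,_)
open import Relation.Binary.PropositionalEquality using (_≡_; _≢_)

-- Vertices of C→_(n:3): part index i ∈ Fin 3 and position a ∈ Fin n (G_i has n vertices).
V : ℕ → Set
V n = Fin 3 × Fin n

nextPart : Fin 3 → Fin 3
nextPart zero = suc zero
nextPart (suc zero) = suc (suc zero)
nextPart (suc (suc zero)) = zero

Arc : {n : ℕ} → V n → V n → Set
Arc (i , _) (j , _) = j ≡ nextPart i

iter : {A : Set} → (A → A) → ℕ → A → A
iter f zero x = x
iter f (suc m) x = f (iter f m x)

-- A spanning subgraph in which every vertex has exactly one out-arc (to f v) and
-- which is a vertex-disjoint union of directed cycles of length ℓ:
-- every arc v → f v is an arc of the digraph, and the orbit of every vertex under f
-- is a directed cycle of length exactly ℓ.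
IsCycleFactor : (n ℓ : ℕ) → (V n → V n) → Set
IsCycleFactor n ℓ f =
  ((v : V n) → Arc v (f v)) ×
  ((v : V n) → (iter f ℓ v ≡ v) × ((j : ℕ) → 0 < j → j < ℓ → iter f j v ≢ v))

Decomposition : (k r : ℕ) → Set
Decomposition k r =
  Σ (Fin (4 ^ k) → V (4 ^ k) → V (4 ^ k)) λ F →
    ((j : Fin (4 ^ k)) →
        (toℕ j < r → IsCycleFactor (4 ^ k) 3 (F j)) ×
        (r ≤ toℕ j → IsCycleFactor (4 ^ k) (3 * 2 ^ k) (F j))) ×
    ((u v : V (4 ^ k)) → Arc u v →
        Σ (Fin (4 ^ k)) λ j → (F j u ≡ v) × ((j′ : Fin (4 ^ k)) → F j′ u ≡ v → j′ ≡ j))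

module Submission where

-- Each part G_i is identified with the abelian group G = ℤ_m × ℤ_m, m = 2^k, whose
-- elements are indexed by Fin (4^k). For every part i we choose a bijection c_i from the
-- factor indices to G, and factor j sends (i , a) to (i + 1 , a + c_i(j)). Since each c_i is
-- a bijection, every arc lies in exactly one factor; and since one turn through the three
-- parts moves a vertex by the drift c_0(j) + c_1(j) + c_2(j), factor j consists of cycles of
-- length 3 · (order of its drift) (module ShiftFactors). Taking c_0 = L ∘ σ, c_1 = (1 - L) ∘ σ
-- and c_2 = -(σ ∘ π) for an automorphism L with L² = L + 1 (the Fibonacci map
-- (x , y) ↦ (y , x + y)), the drift of factor j becomes σ(j) - σ(π(j)) (module Golden).
-- It remains to choose permutations σ and π of the indices such that π fixes the first r
-- indices and σ(j) - σ(π(j)) has an odd coordinate, hence order m, for all other j. In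
-- module Indices, π is a product of two rotations of index segments that changes parities,
-- except at one pair, which the transposition σ of the indices 1 and 4^k - 3 separates
-- in the other coordinate.

open import Defs
open import Data.Nat using (ℕ; _<_; _≤_; _^_; _∸_)
open import Relation.Binary.PropositionalEquality using (_≢_)

open import Data.Nat.Base
  using (zero; suc; pred; _+_; _*_; _%_; _/_; z≤n; s≤s; s≤s⁻¹; parity; NonZero; >-nonZero)
open import Data.Nat.Properties
  using (+-suc; +-comm; +-assoc; +-identityʳ; *-comm; *-assoc; *-zeroʳ; +-commutativeSemigroup;
         <-cmp; _≤?_; _<?_; ≰⇒>; ≮⇒≥; <⇒≱; <⇒≤; ≤∧≢⇒<; <-irrefl; ≤-refl; ≤-trans; <-trans;
         <-≤-trans; ≤-<-trans; n≤1+n; n<1+n; pred[n]≤n; suc-injective; suc-pred; m+[n∸m]≡n;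
         *-mono-≤; *-monoʳ-≤; m^n>0; m^n≢0; ^-*-assoc; ^-distribˡ-+-*)
open import Data.Nat.DivMod
  using (_mod_; m%n<n; m%n%n≡m%n; [m+kn]%n≡m%n; %-distribˡ-+; %-distribˡ-*; m<n⇒m%n≡m;
         m≡m%n+[m/n]*n; m<n*o⇒m/o<n)
open import Data.Nat.Divisibility
  using (_∣_; divides; ∣-trans; *-cancelˡ-∣; *-monoʳ-∣; 1∣_; m∣m*n; m%n≡0⇒n∣m; ∣⇒≤)
open import Data.Parity.Base using (Parity; 0ℙ; 1ℙ) renaming (_⁻¹ to other; _+_ to _ℙ+_; _*_ to _ℙ*_)
open import Data.Parity.Properties
  using (+-homo-+; *-homo-*; p≢p⁻¹) renaming (*-zeroʳ to ℙ*-zeroʳ; *-identityʳ to ℙ*-identityʳ)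
open import Data.Fin.Base using (Fin; toℕ; fromℕ<; combine; remQuot; quotient; remainder)
open import Data.Fin.Properties
  using (toℕ<n; toℕ-fromℕ<; toℕ-injective; remQuot-combine; combine-remQuot; toℕ-combine; _≟_)
open import Data.Fin.Patterns using (0F; 1F; 2F)
open import Data.Fin.Permutation
  using (Permutation′; permutation; transpose; _∘ₚ_; _⟨$⟩ʳ_; _⟨$⟩ˡ_; inverseˡ; inverseʳ)
open import Data.Product.Base using (Σ; ∃-syntax; _×_; _,_; proj₁; proj₂; uncurry)
open import Data.Sum.Base using (_⊎_; inj₁; inj₂)
open import Algebra.Core using (Op₁; Op₂)
open import Algebra.Structures using (IsAbelianGroup)
open import Algebra.Bundles using (AbelianGroup; Group)
import Algebra.Properties.AbelianGroup as AbelianGroupProperties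
import Algebra.Properties.Monoid.Mult as MonoidMultiplication
open import Algebra.Properties.CommutativeSemigroup +-commutativeSemigroup using (interchange)
open import Level using (0ℓ)
open import Relation.Binary.Bundles using (Setoid)
open import Relation.Binary.Definitions using (tri<; tri≈; tri>)
open import Relation.Binary.PropositionalEquality
  using (_≡_; refl; sym; trans; cong; cong₂; subst; subst₂; module ≡-Reasoning)
open import Relation.Binary.PropositionalEquality.Properties using (isEquivalence)
import Relation.Binary.Reasoning.Setoid as SetoidReasoning
open import Relation.Nullary.Decidable using (yes; no)
open import Relation.Nullary.Negation using (¬_; contradiction)

parity≡0ℙ⇒double : ∀ n → parity n ≡ 0ℙ → ∃[ q ] n ≡ 2 * q
parity≡0ℙ⇒double zero _ = 0 , refl
parity≡0ℙ⇒double (suc (suc n)) p with q , refl ← parity≡0ℙ⇒double n p =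
  suc q , cong suc (sym (+-suc q (q + 0)))

2∣⇒parity≡0ℙ : ∀ {n} → 2 ∣ n → parity n ≡ 0ℙ
2∣⇒parity≡0ℙ (divides q refl) = trans (*-homo-* q 2) (ℙ*-zeroʳ (parity q))

even-product⇒even : ∀ t {o} → parity o ≡ 1ℙ → parity (t * o) ≡ 0ℙ → parity t ≡ 0ℙ
even-product⇒even t {o} odd even = begin
  parity t             ≡⟨ sym (ℙ*-identityʳ (parity t)) ⟩
  parity t ℙ* 1ℙ       ≡⟨ cong (parity t ℙ*_) (sym odd) ⟩
  parity t ℙ* parity o ≡⟨ sym (*-homo-* t o) ⟩
  parity (t * o)       ≡⟨ even ⟩
  0ℙ                   ∎
  where open ≡-Reasoning

2^k∣t*odd⇒2^k∣t : ∀ k t {o} → parity o ≡ 1ℙ → 2 ^ k ∣ t * o → 2 ^ k ∣ t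
2^k∣t*odd⇒2^k∣t zero t _ _ = 1∣ t
2^k∣t*odd⇒2^k∣t (suc k) t {o} odd 2^k+1∣to
  with q , refl ← parity≡0ℙ⇒double t
         (even-product⇒even t odd (2∣⇒parity≡0ℙ (∣-trans (m∣m*n (2 ^ k)) 2^k+1∣to))) =
  *-monoʳ-∣ 2 (2^k∣t*odd⇒2^k∣t k q odd
    (*-cancelˡ-∣ 2 (subst (2 ^ suc k ∣_) (*-assoc 2 q o) 2^k+1∣to)))

odd-before-even : ∀ n → parity (suc n) ≡ 0ℙ → parity n ≡ 1ℙ
odd-before-even zero          ()
odd-before-even (suc zero)    _    = refl
odd-before-even (suc (suc n)) even = odd-before-even n even

parity-suc : ∀ n → parity (suc n) ≡ other (parity n)
parity-suc zero          = refl
parity-suc (suc zero)    = refl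
parity-suc (suc (suc n)) = parity-suc n

parity-suc≢ : ∀ n → parity (suc n) ≢ parity n
parity-suc≢ n eq = p≢p⁻¹ (parity n) (trans (sym eq) (parity-suc n))

iter-+ : ∀ {A : Set} (f : A → A) a b x → iter f (a + b) x ≡ iter f a (iter f b x)
iter-+ f zero    b x = refl
iter-+ f (suc a) b x = cong f (iter-+ f a b x)

iter-periodic : ∀ {A : Set} (f : A → A) p → (∀ x → iter f p x ≡ x) → ∀ q x → iter f (q * p) x ≡ x
iter-periodic f p period zero    x = refl
iter-periodic f p period (suc q) x =
  trans (iter-+ f p (q * p) x) (trans (cong (iter f p) (iter-periodic f p period q x)) (period x))

nextPart-period : ∀ i → iter nextPart 3 i ≡ i
nextPart-period 0F = refl
nextPart-period 1F = refl
nextPart-period 2F = refl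

nextPart-no-early-return : ∀ e i → 0 < e → e < 3 → iter nextPart e i ≢ i
nextPart-no-early-return 1 0F _ _ ()
nextPart-no-early-return 1 1F _ _ ()
nextPart-no-early-return 1 2F _ _ ()
nextPart-no-early-return 2 0F _ _ ()
nextPart-no-early-return 2 1F _ _ ()
nextPart-no-early-return 2 2F _ _ ()
nextPart-no-early-return (suc (suc (suc _))) _ _ (s≤s (s≤s (s≤s ())))

nextPart-return : ∀ e i → iter nextPart e i ≡ i → e % 3 ≡ 0
nextPart-return e i return with e % 3 in ρ-eq | m%n<n e 3
... | zero          | _     = refl
... | ρ@(suc _)     | ρ<3   = contradiction reduced (nextPart-no-early-return ρ i (s≤s z≤n) ρ<3)
  where
  q : ℕ
  q = e / 3
  e≡ρ+q*3 : e ≡ ρ + q * 3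
  e≡ρ+q*3 = trans (m≡m%n+[m/n]*n e 3) (cong (_+ q * 3) ρ-eq)
  reduced : iter nextPart ρ i ≡ i
  reduced = begin
    iter nextPart ρ i                    ≡⟨ cong (iter nextPart ρ) (iter-periodic nextPart 3 nextPart-period q i) ⟨
    iter nextPart ρ (iter nextPart (q * 3) i) ≡⟨ iter-+ nextPart ρ (q * 3) i ⟨
    iter nextPart (ρ + q * 3) i          ≡⟨ cong (λ e′ → iter nextPart e′ i) e≡ρ+q*3 ⟨
    iter nextPart e i                    ≡⟨ return ⟩
    i                                    ∎
    where open ≡-Reasoning

CycleDecomposition : (n r ℓ : ℕ) → Set
CycleDecomposition n r ℓ =
  Σ (Fin n → V n → V n) λ F →
    ((j : Fin n) →
        (toℕ j < r → IsCycleFactor n 3 (F j)) ×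
        (r ≤ toℕ j → IsCycleFactor n ℓ (F j))) ×
    ((u v : V n) → Arc u v →
        Σ (Fin n) λ j → (F j u ≡ v) × ((j′ : Fin n) → F j′ u ≡ v → j′ ≡ j))

-- Identify each part G_i with an abelian group on Fin n and choose, for every
-- part i, a bijection c i from factor indices to group elements. Factor j moves (i , a) to
-- (i + 1 , a + c i j); after one turn through the three parts a vertex is displaced by the
-- drift c 0 j + c 1 j + c 2 j, so the factor's cycle length is 3 times the drift's order.
module ShiftFactors {n : ℕ} {add : Op₂ (Fin n)} {zero# : Fin n} {neg : Op₁ (Fin n)}
                    (isAbelianGroup : IsAbelianGroup _≡_ add zero# neg) where

  private
    G : AbelianGroup 0ℓ 0ℓ
    G = record { isAbelianGroup = isAbelianGroup }

  open AbelianGroup G public using (_∙_; ε; _⁻¹; _-_)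
  open AbelianGroup G using (assoc; comm; identityˡ; identityʳ)
    renaming (inverseˡ to ∙-inverseˡ; inverseʳ to ∙-inverseʳ)
  open Group (AbelianGroup.group G) using (_\\_)
  open AbelianGroupProperties G
    using (\\-leftDividesˡ; y≈x\\z; identityˡ-unique; identityʳ-unique; inverseˡ-unique;
           ⁻¹-involutive; ⁻¹-anti-homo-∙; xyx⁻¹≈y)
  open MonoidMultiplication (AbelianGroup.monoid G) public using () renaming (_×_ to _·_)

  HasOrder : ℕ → Fin n → Set
  HasOrder M g = (M · g ≡ ε) × (∀ t → 0 < t → t < M → t · g ≢ ε)

  inversion : Permutation′ n
  inversion = permutation _⁻¹ _⁻¹ ⁻¹-involutive ⁻¹-involutive

  module _ (c : Fin 3 → Permutation′ n) where

    step : Fin 3 → Fin n → Fin n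
    step i j = c i ⟨$⟩ʳ j

    factor : Fin n → V n → V n
    factor j (i , a) = nextPart i , a ∙ step i j

    drift : Fin n → Fin n
    drift j = step 0F j ∙ step 1F j ∙ step 2F j

    each-arc-once : (u v : V n) → Arc u v →
                    Σ (Fin n) λ j → (factor j u ≡ v) × ((j′ : Fin n) → factor j′ u ≡ v → j′ ≡ j)
    each-arc-once (i , a) (_ , b) refl = c i ⟨$⟩ˡ (a \\ b) , covers , unique
      where
      covers : factor (c i ⟨$⟩ˡ (a \\ b)) (i , a) ≡ (nextPart i , b)
      covers = cong (nextPart i ,_) (trans (cong (a ∙_) (inverseʳ (c i))) (\\-leftDividesˡ a b))
      unique : (j′ : Fin n) → factor j′ (i , a) ≡ (nextPart i , b) → j′ ≡ c i ⟨$⟩ˡ (a \\ b)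
      unique j′ moves = trans (sym (inverseˡ (c i))) (cong (c i ⟨$⟩ˡ_) (y≈x\\z a _ b (cong proj₂ moves)))

    regroup : ∀ a x y z → a ∙ x ∙ y ∙ z ≡ a ∙ (x ∙ y ∙ z)
    regroup a x y z = trans (cong (_∙ z) (assoc a x y)) (assoc a (x ∙ y) z)

    rotate₃ : ∀ x y z → y ∙ z ∙ x ≡ x ∙ y ∙ z
    rotate₃ x y z = trans (comm (y ∙ z) x) (sym (assoc x y z))

    full-turn : ∀ j i a → iter (factor j) 3 (i , a) ≡ (i , a ∙ drift j)
    full-turn j 0F a = cong (0F ,_) (regroup a _ _ _)
    full-turn j 1F a = cong (1F ,_) (trans (regroup a _ _ _) (cong (a ∙_) (rotate₃ _ _ _)))
    full-turn j 2F a = cong (2F ,_) (trans (regroup a _ _ _)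
                         (cong (a ∙_) (trans (rotate₃ _ _ _) (rotate₃ _ _ _))))

    turns : ∀ j t i a → iter (factor j) (t * 3) (i , a) ≡ (i , a ∙ t · drift j)
    turns j zero    i a = cong (i ,_) (sym (identityʳ a))
    turns j (suc t) i a = begin
      iter (factor j) (3 + t * 3) (i , a)             ≡⟨ iter-+ (factor j) 3 (t * 3) (i , a) ⟩
      iter (factor j) 3 (iter (factor j) (t * 3) (i , a)) ≡⟨ cong (iter (factor j) 3) (turns j t i a) ⟩
      iter (factor j) 3 (i , a ∙ t · d)               ≡⟨ full-turn j i (a ∙ t · d) ⟩
      (i , a ∙ t · d ∙ d)
        ≡⟨ cong (i ,_) (trans (assoc a (t · d) d) (cong (a ∙_) (comm (t · d) d))) ⟩
      (i , a ∙ (d ∙ t · d))                           ∎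
      where
      open ≡-Reasoning
      d = drift j

    part-of-walk : ∀ j e v → proj₁ (iter (factor j) e v) ≡ iter nextPart e (proj₁ v)
    part-of-walk j zero    v = refl
    part-of-walk j (suc e) v = cong nextPart (part-of-walk j e v)

    factor-cycles : ∀ j M → HasOrder M (drift j) → IsCycleFactor n (3 * M) (factor j)
    factor-cycles j M (M·d≡0 , no-smaller) = (λ _ → refl) , λ (i , a) → closes i a , no-early i a
      where
      closes : ∀ i a → iter (factor j) (3 * M) (i , a) ≡ (i , a)
      closes i a = begin
        iter (factor j) (3 * M) (i , a) ≡⟨ cong (λ e → iter (factor j) e (i , a)) (*-comm 3 M) ⟩
        iter (factor j) (M * 3) (i , a) ≡⟨ turns j M i a ⟩
        (i , a ∙ M · drift j)          ≡⟨ cong (λ x → i , a ∙ x) M·d≡0 ⟩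
        (i , a ∙ ε)                   ≡⟨ cong (i ,_) (identityʳ a) ⟩
        (i , a)                        ∎
        where open ≡-Reasoning
      no-early : ∀ i a e → 0 < e → e < 3 * M → iter (factor j) e (i , a) ≢ (i , a)
      no-early i a e 0<e e<3M returns = no-smaller (e / 3) 0<e/3 e/3<M q·d≡0
        where
        same-part : iter nextPart e i ≡ i
        same-part = trans (sym (part-of-walk j e (i , a))) (cong proj₁ returns)
        e≡e/3*3 : e ≡ e / 3 * 3
        e≡e/3*3 = trans (m≡m%n+[m/n]*n e 3) (cong (_+ e / 3 * 3) (nextPart-return e i same-part))
        0<e/3 : 0 < e / 3
        0<e/3 with e / 3 in q-eq
        ... | zero  = contradiction (trans e≡e/3*3 (cong (_* 3) q-eq)) λ e≡0 → <-irrefl (sym e≡0) 0<e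
        ... | suc _ = s≤s z≤n
        e/3<M : e / 3 < M
        e/3<M = m<n*o⇒m/o<n (subst (e <_) (*-comm 3 M) e<3M)
        q·d≡0 : (e / 3) · drift j ≡ ε
        q·d≡0 = identityʳ-unique a _ (cong proj₂ (begin
          (i , a ∙ (e / 3) · drift j)         ≡⟨ sym (turns j (e / 3) i a) ⟩
          iter (factor j) (e / 3 * 3) (i , a) ≡⟨ cong (λ e′ → iter (factor j) e′ (i , a)) (sym e≡e/3*3) ⟩
          iter (factor j) e (i , a)         ≡⟨ returns ⟩
          (i , a)                           ∎))
          where open ≡-Reasoning

    zero-drift-cycles : ∀ j → drift j ≡ ε → IsCycleFactor n 3 (factor j)
    zero-drift-cycles j d≡0 =
      factor-cycles j 1 (trans (identityʳ (drift j)) d≡0 , λ { zero () _ ; (suc _) _ (s≤s ()) })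

    shift-decomposition : ∀ r M →
      (∀ j → toℕ j < r → drift j ≡ ε) →
      (∀ j → r ≤ toℕ j → HasOrder M (drift j)) →
      CycleDecomposition n r (3 * M)
    shift-decomposition r M short long =
      factor ,
      (λ j → (λ j<r → zero-drift-cycles j (short j j<r)) , (λ r≤j → factor-cycles j M (long j r≤j))) ,
      each-arc-once

  -- An additive map L with L² = L + 1 is invertible, with inverse L - 1; so is its
  -- complement 1 - L, with inverse -L.
  module Golden (L : Fin n → Fin n) (L-∙ : ∀ x y → L (x ∙ y) ≡ L x ∙ L y)
                (L² : ∀ x → L (L x) ≡ L x ∙ x) where

    L-ε : L ε ≡ ε
    L-ε = identityˡ-unique (L ε) (L ε) (trans (sym (L-∙ ε ε)) (cong L (identityˡ ε)))

    L-⁻¹ : ∀ x → L (x ⁻¹) ≡ L x ⁻¹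
    L-⁻¹ x = inverseˡ-unique (L (x ⁻¹)) (L x)
               (trans (sym (L-∙ (x ⁻¹) x)) (trans (cong L (∙-inverseˡ x)) L-ε))

    golden : ∀ x → L (L x) - L x ≡ x
    golden x = trans (cong (_- L x) (L² x)) (xyx⁻¹≈y (L x) x)

    L-permutation : Permutation′ n
    L-permutation = permutation L (λ x → L x - x)
      (λ x → trans (L-∙ (L x) (x ⁻¹)) (trans (cong (L (L x) ∙_) (L-⁻¹ x)) (golden x)))
      golden

    complement : Fin n → Fin n
    complement x = L x ⁻¹ ∙ x

    complement-permutation : Permutation′ n
    complement-permutation = permutation complement (λ x → L x ⁻¹) right-inverse left-inverse
      where
      open ≡-Reasoning
      right-inverse : ∀ x → complement (L x ⁻¹) ≡ x
      right-inverse x = begin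
        L (L x ⁻¹) ⁻¹ ∙ L x ⁻¹   ≡⟨ cong (λ y → y ⁻¹ ∙ L x ⁻¹) (L-⁻¹ (L x)) ⟩
        L (L x) ⁻¹ ⁻¹ ∙ L x ⁻¹   ≡⟨ cong (_- L x) (⁻¹-involutive (L (L x))) ⟩
        L (L x) - L x            ≡⟨ golden x ⟩
        x                        ∎
      left-inverse : ∀ x → L (complement x) ⁻¹ ≡ x
      left-inverse x = begin
        L (L x ⁻¹ ∙ x) ⁻¹        ≡⟨ cong _⁻¹ (L-∙ (L x ⁻¹) x) ⟩
        (L (L x ⁻¹) ∙ L x) ⁻¹    ≡⟨ cong (λ y → (y ∙ L x) ⁻¹) (L-⁻¹ (L x)) ⟩
        (L (L x) ⁻¹ ∙ L x) ⁻¹    ≡⟨ ⁻¹-anti-homo-∙ (L (L x) ⁻¹) (L x) ⟩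
        L x ⁻¹ ∙ L (L x) ⁻¹ ⁻¹   ≡⟨ cong (L x ⁻¹ ∙_) (⁻¹-involutive (L (L x))) ⟩
        L x ⁻¹ ∙ L (L x)         ≡⟨ comm (L x ⁻¹) (L (L x)) ⟩
        L (L x) - L x            ≡⟨ golden x ⟩
        x                        ∎

    L-complement : ∀ x → L x ∙ complement x ≡ x
    L-complement x = \\-leftDividesˡ (L x) x

    -- The shift construction: with connectors L ∘ σ, (1 - L) ∘ σ and -(σ ∘ π), factor j
    -- has drift σ j - σ (π j).
    connectors : Permutation′ n → Permutation′ n → Fin 3 → Permutation′ n
    connectors σ π 0F = σ ∘ₚ L-permutation
    connectors σ π 1F = σ ∘ₚ complement-permutation
    connectors σ π 2F = π ∘ₚ σ ∘ₚ inversion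

    golden-decomposition : ∀ (σ π : Permutation′ n) r M →
      (∀ j → toℕ j < r → π ⟨$⟩ʳ j ≡ j) →
      (∀ j → r ≤ toℕ j → HasOrder M ((σ ⟨$⟩ʳ j) - (σ ⟨$⟩ʳ (π ⟨$⟩ʳ j)))) →
      CycleDecomposition n r (3 * M)
    golden-decomposition σ π r M fixes order = shift-decomposition (connectors σ π) r M
      (λ j j<r → trans (drift≡ j) (trans (cong (λ i → (σ ⟨$⟩ʳ j) - (σ ⟨$⟩ʳ i)) (fixes j j<r))
                                         (∙-inverseʳ (σ ⟨$⟩ʳ j))))
      (λ j r≤j → subst (HasOrder M) (sym (drift≡ j)) (order j r≤j))
      where
      drift≡ : ∀ j → drift (connectors σ π) j ≡ (σ ⟨$⟩ʳ j) - (σ ⟨$⟩ʳ (π ⟨$⟩ʳ j))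
      drift≡ j = cong (_∙ (σ ⟨$⟩ʳ (π ⟨$⟩ʳ j)) ⁻¹) (L-complement (σ ⟨$⟩ʳ j))

module _ (N : ℕ) (f g : ℕ → ℕ) (f-< : ∀ n → n < N → f n < N) (g-< : ∀ n → n < N → g n < N)
         (f∘g : ∀ n → f (g n) ≡ n) (g∘f : ∀ n → g (f n) ≡ n) where

  restrict : (h : ℕ → ℕ) → (∀ n → n < N → h n < N) → Fin N → Fin N
  restrict h h-< j = fromℕ< (h-< (toℕ j) (toℕ<n j))

  restrict-inverse : ∀ h h-< k k-< → (∀ n → h (k n) ≡ n) → ∀ j → restrict h h-< (restrict k k-< j) ≡ j
  restrict-inverse h h-< k k-< h∘k j =
    toℕ-injective (trans (toℕ-fromℕ< _) (trans (cong h (toℕ-fromℕ< _)) (h∘k (toℕ j))))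

  restriction : Permutation′ N
  restriction = permutation (restrict f f-<) (restrict g g-<)
                  (restrict-inverse f f-< g g-< f∘g) (restrict-inverse g g-< f f-< g∘f)

data Place (a b n : ℕ) : Set where
  outside : n < a ⊎ b ≤ n → Place a b n
  inner   : a ≤ n → suc n < b → Place a b n
  last    : a ≤ n → suc n ≡ b → Place a b n

place : ∀ a b n → Place a b n
place a b n with a ≤? n | <-cmp (suc n) b
... | no  n≱a | _             = outside (inj₁ (≰⇒> n≱a))
... | yes a≤n | tri< sn<b _ _ = inner a≤n sn<b
... | yes a≤n | tri≈ _ sn≡b _ = last a≤n sn≡b
... | yes a≤n | tri> _ _ b<sn = outside (inj₂ (s≤s⁻¹ b<sn))

rotate : ℕ → ℕ → ℕ → ℕ
rotate a b n with place a b n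
... | outside _ = n
... | inner _ _ = suc n
... | last _ _  = a

data Place⁻ (a b n : ℕ) : Set where
  outside : n < a ⊎ b ≤ n → Place⁻ a b n
  first   : a ≡ n → n < b → Place⁻ a b n
  later   : a < n → n < b → Place⁻ a b n

place⁻ : ∀ a b n → Place⁻ a b n
place⁻ a b n with <-cmp a n | n <? b
... | _            | no n≮b  = outside (inj₂ (≮⇒≥ n≮b))
... | tri> _ _ n<a | yes _   = outside (inj₁ n<a)
... | tri≈ _ a≡n _ | yes n<b = first a≡n n<b
... | tri< a<n _ _ | yes n<b = later a<n n<b

unrotate : ℕ → ℕ → ℕ → ℕ
unrotate a b n with place⁻ a b n
... | outside _ = n
... | first _ _ = pred b
... | later _ _ = pred n

below-if-≢ : ∀ {a b} → a ≤ suc b → a ≢ suc b → a ≤ b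
below-if-≢ a≤1+b a≢1+b = s≤s⁻¹ (≤∧≢⇒< a≤1+b a≢1+b)

not-outside : ∀ {a b n} → a ≤ n → n < b → ¬ (n < a ⊎ b ≤ n)
not-outside a≤n n<b (inj₁ n<a) = <⇒≱ n<a a≤n
not-outside a≤n n<b (inj₂ b≤n) = <⇒≱ n<b b≤n

rotate-outside : ∀ {a b n} → n < a ⊎ b ≤ n → rotate a b n ≡ n
rotate-outside {a} {b} {n} out with place a b n
... | outside _         = refl
... | inner a≤n sn<b    = contradiction out (not-outside a≤n (<-trans (n<1+n n) sn<b))
... | last a≤n refl     = contradiction out (not-outside a≤n (n<1+n n))

rotate-inner : ∀ {a b n} → a ≤ n → suc n < b → rotate a b n ≡ suc n
rotate-inner {a} {b} {n} a≤n sn<b with place a b n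
... | outside out   = contradiction out (not-outside a≤n (<-trans (n<1+n n) sn<b))
... | inner _ _     = refl
... | last _ refl   = contradiction sn<b (<-irrefl refl)

rotate-last : ∀ {a n} → a ≤ n → rotate a (suc n) n ≡ a
rotate-last {a} {n} a≤n with place a (suc n) n
... | outside out  = contradiction out (not-outside a≤n (n<1+n n))
... | inner _ sn<b = contradiction sn<b (<-irrefl refl)
... | last _ _     = refl

unrotate-outside : ∀ {a b n} → n < a ⊎ b ≤ n → unrotate a b n ≡ n
unrotate-outside {a} {b} {n} out with place⁻ a b n
... | outside _      = refl
... | first refl n<b = contradiction out (not-outside ≤-refl n<b)
... | later a<n n<b  = contradiction out (not-outside (<⇒≤ a<n) n<b)

unrotate-first : ∀ {a b} → a < b → unrotate a b a ≡ pred b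
unrotate-first {a} {b} a<b with place⁻ a b a
... | outside out = contradiction out (not-outside ≤-refl a<b)
... | first _ _   = refl
... | later a<a _ = contradiction a<a (<-irrefl refl)

unrotate-later : ∀ {a b n} → a < n → n < b → unrotate a b n ≡ pred n
unrotate-later {a} {b} {n} a<n n<b with place⁻ a b n
... | outside out = contradiction out (not-outside (<⇒≤ a<n) n<b)
... | first refl _ = contradiction a<n (<-irrefl refl)
... | later _ _   = refl

unrotate-rotate : ∀ a b n → unrotate a b (rotate a b n) ≡ n
unrotate-rotate a b n with place a b n
... | outside out    = unrotate-outside out
... | inner a≤n sn<b = unrotate-later (s≤s a≤n) sn<b
... | last a≤n refl  = unrotate-first (s≤s a≤n)

rotate-unrotate : ∀ a b n → rotate a b (unrotate a b n) ≡ n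
rotate-unrotate a b n with place⁻ a b n
... | outside out            = rotate-outside out
... | first refl (s≤s a≤b-1) = rotate-last a≤b-1
... | later (s≤s a≤n-1) n<b  = rotate-inner a≤n-1 n<b

rotate-< : ∀ {a b N} n → b ≤ N → n < N → rotate a b n < N
rotate-< {a} {b} n b≤N n<N with place a b n
... | outside _     = n<N
... | inner _ sn<b  = <-≤-trans sn<b b≤N
... | last a≤n _    = ≤-<-trans a≤n n<N

unrotate-< : ∀ {a b N} n → b ≤ N → n < N → unrotate a b n < N
unrotate-< {a} {b} n b≤N n<N with place⁻ a b n
... | outside _                = n<N
... | first _ (s≤s {n = b-1} _) = <-≤-trans (n<1+n b-1) b≤N
... | later _ _                = ≤-<-trans pred[n]≤n n<N

rotation : ∀ {N} a b → b ≤ N → Permutation′ N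
rotation {N} a b b≤N = restriction N (rotate a b) (unrotate a b)
  (λ n → rotate-< {a} n b≤N) (λ n → unrotate-< {a} n b≤N) (rotate-unrotate a b) (unrotate-rotate a b)

toℕ-rotation : ∀ {N} a b (b≤N : b ≤ N) j → toℕ (rotation a b b≤N ⟨$⟩ʳ j) ≡ rotate a b (toℕ j)
toℕ-rotation a b b≤N j = toℕ-fromℕ< _

transpose-other : ∀ {N} {i j k : Fin N} → k ≢ i → k ≢ j → transpose i j ⟨$⟩ʳ k ≡ k
transpose-other {i = i} {j} {k} k≢i k≢j with k ≟ i
... | yes k≡i = contradiction k≡i k≢i
... | no _ with k ≟ j
...   | yes k≡j = contradiction k≡j k≢j
...   | no _    = refl

transpose-second : ∀ {N} (i j : Fin N) → transpose i j ⟨$⟩ʳ j ≡ i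
transpose-second i j with j ≟ i
... | yes j≡i = j≡i
... | no _ with j ≟ j
...   | yes _  = refl
...   | no j≢j = contradiction refl j≢j

transpose-parity : ∀ {N} (i j k : Fin N) → parity (toℕ i) ≡ parity (toℕ j) →
                   parity (toℕ (transpose i j ⟨$⟩ʳ k)) ≡ parity (toℕ k)
transpose-parity i j k same with k ≟ i
... | yes refl = sym same
... | no _ with k ≟ j
...   | yes refl = same
...   | no _     = refl

module Indices (N Y : ℕ) (N≡3+Y : N ≡ 3 + Y) (Y-odd : parity Y ≡ 1ℙ) where

  parity-N : parity N ≡ 0ℙ
  parity-N = trans (cong parity N≡3+Y) (trans (parity-suc Y) (cong other Y-odd))

  1<N : 1 < N
  1<N = subst (1 <_) (sym N≡3+Y) (s≤s (s≤s z≤n))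

  Y<N : Y < N
  Y<N = subst (Y <_) (sym N≡3+Y) (s≤s (≤-trans (n≤1+n Y) (n≤1+n (suc Y))))

  relabel : Permutation′ N
  relabel = transpose (fromℕ< 1<N) (fromℕ< Y<N)

  relabel-parity : ∀ j → parity (toℕ (relabel ⟨$⟩ʳ j)) ≡ parity (toℕ j)
  relabel-parity j = transpose-parity (fromℕ< 1<N) (fromℕ< Y<N) j
    (trans (cong parity (toℕ-fromℕ< 1<N)) (sym (trans (cong parity (toℕ-fromℕ< Y<N)) Y-odd)))

  relabel-last : ∀ j → toℕ j ≡ 2 + Y → toℕ (relabel ⟨$⟩ʳ j) ≡ 2 + Y
  relabel-last j j≡2+Y = trans (cong toℕ (transpose-other j≢1 j≢Y)) j≡2+Y
    where
    j≢1 : j ≢ fromℕ< 1<N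
    j≢1 j≡1 = contradiction (trans (sym j≡2+Y) (trans (cong toℕ j≡1) (toℕ-fromℕ< 1<N))) λ ()
    j≢Y : j ≢ fromℕ< Y<N
    j≢Y j≡Y = <-irrefl (trans (sym (toℕ-fromℕ< Y<N)) (trans (cong toℕ (sym j≡Y)) j≡2+Y)) (s≤s (n≤1+n Y))

  relabel-Y : ∀ j → toℕ j ≡ Y → toℕ (relabel ⟨$⟩ʳ j) ≡ 1
  relabel-Y j j≡Y = begin
    toℕ (relabel ⟨$⟩ʳ j)           ≡⟨ cong (λ i → toℕ (relabel ⟨$⟩ʳ i)) j≡y ⟩
    toℕ (relabel ⟨$⟩ʳ fromℕ< Y<N)  ≡⟨ cong toℕ (transpose-second (fromℕ< 1<N) (fromℕ< Y<N)) ⟩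
    toℕ (fromℕ< 1<N)              ≡⟨ toℕ-fromℕ< 1<N ⟩
    1                             ∎
    where
    open ≡-Reasoning
    j≡y : j ≡ fromℕ< Y<N
    j≡y = toℕ-injective (trans j≡Y (sym (toℕ-fromℕ< Y<N)))

  Separated : Fin N → Fin N → Set
  Separated i i′ = parity (toℕ i) ≢ parity (toℕ i′) ⊎ (toℕ i ≡ 2 + Y × toℕ i′ ≡ 1)

  -- Given r ≤ N with r ≠ N - 1, the permutation `cycles` fixes every index below r and
  -- moves every index j ≥ r to an index of the other parity, except for N - 1 ↦ Y. It is
  -- the rotation of [r, E) followed by that of [E, N), where E = N for even r and E = Y
  -- for odd r (then [E, N) is the triangle Y, Y + 1, Y + 2).
  module Cycles (r : ℕ) (r≤N : r ≤ N) (r≢2+Y : r ≢ 2 + Y) where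

    cycleEnd : Parity → ℕ
    cycleEnd 0ℙ = N
    cycleEnd 1ℙ = Y

    E : ℕ
    E = cycleEnd (parity r)

    r≤E : r ≤ E
    r≤E with parity r in r-parity
    ... | 0ℙ = r≤N
    ... | 1ℙ = below-if-≢ (below-if-≢ (below-if-≢ (subst (r ≤_) N≡3+Y r≤N) r≢N) r≢2+Y) r≢1+Y
      where
      r≢N : r ≢ 3 + Y
      r≢N r≡N = p≢p⁻¹ 0ℙ (trans (sym parity-N) (trans (cong parity (trans N≡3+Y (sym r≡N))) r-parity))
      r≢1+Y : r ≢ 1 + Y
      r≢1+Y r≡1+Y = p≢p⁻¹ 1ℙ (trans (sym r-parity)
                      (trans (cong parity r≡1+Y) (trans (parity-suc Y) (cong other Y-odd))))

    E≤N : E ≤ N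
    E≤N with parity r
    ... | 0ℙ = ≤-refl
    ... | 1ℙ = <⇒≤ Y<N

    parity-E : parity E ≡ parity r
    parity-E with parity r
    ... | 0ℙ = parity-N
    ... | 1ℙ = Y-odd

    E<N⇒E≡Y : E < N → E ≡ Y
    E<N⇒E≡Y E<N with parity r
    ... | 0ℙ = contradiction E<N (<-irrefl refl)
    ... | 1ℙ = refl

    cycles : Permutation′ N
    cycles = rotation E N ≤-refl ∘ₚ rotation r E E≤N

    toℕ-cycles : ∀ j → toℕ (cycles ⟨$⟩ʳ j) ≡ rotate r E (rotate E N (toℕ j))
    toℕ-cycles j = trans (toℕ-rotation r E E≤N _) (cong (rotate r E) (toℕ-rotation E N ≤-refl j))

    cycles-fixes : ∀ j → toℕ j < r → cycles ⟨$⟩ʳ j ≡ j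
    cycles-fixes j j<r = toℕ-injective (trans (toℕ-cycles j)
      (trans (cong (rotate r E) (rotate-outside (inj₁ (≤-trans j<r r≤E)))) (rotate-outside (inj₁ j<r))))

    -- Within the first cycle the parity always changes (at the wrap E - 1 ↦ r because E ≡ r mod 2).
    first-cycle : ∀ n → r ≤ n → n < E → parity (rotate r E n) ≢ parity n
    first-cycle n r≤n n<E with place r E n
    ... | outside out  = contradiction out (not-outside r≤n n<E)
    ... | inner _ _    = parity-suc≢ n
    ... | last _ sn≡E  = λ r~n → parity-suc≢ n (trans (cong parity sn≡E) (trans parity-E r~n))

    cycles-moves : ∀ n → r ≤ n → n < N →
                   parity (rotate r E (rotate E N n)) ≢ parity n ⊎ (n ≡ 2 + Y × rotate r E (rotate E N n) ≡ Y)
    cycles-moves n r≤n n<N with place E N n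
    ... | outside (inj₁ n<E) = inj₁ (first-cycle n r≤n n<E)
    ... | outside (inj₂ N≤n) = contradiction N≤n (<⇒≱ n<N)
    ... | inner E≤n _        =
      inj₁ (subst (λ n′ → parity n′ ≢ parity n)
                  (sym (rotate-outside {r} {E} (inj₂ (≤-trans E≤n (n≤1+n n))))) (parity-suc≢ n))
    ... | last E≤n sn≡N      =
      inj₂ (suc-injective (trans sn≡N N≡3+Y) ,
            trans (rotate-outside {r} {E} (inj₂ ≤-refl)) (E<N⇒E≡Y (≤-<-trans E≤n n<N)))

    separated : ∀ j → r ≤ toℕ j → Separated (relabel ⟨$⟩ʳ j) (relabel ⟨$⟩ʳ (cycles ⟨$⟩ʳ j))
    separated j r≤j with cycles-moves (toℕ j) r≤j (toℕ<n j)
    ... | inj₁ flips = inj₁ λ same → flips (sym (begin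
          parity (toℕ j)                                   ≡⟨ relabel-parity j ⟨
          parity (toℕ (relabel ⟨$⟩ʳ j))                     ≡⟨ same ⟩
          parity (toℕ (relabel ⟨$⟩ʳ (cycles ⟨$⟩ʳ j)))       ≡⟨ relabel-parity (cycles ⟨$⟩ʳ j) ⟩
          parity (toℕ (cycles ⟨$⟩ʳ j))                      ≡⟨ cong parity (toℕ-cycles j) ⟩
          parity (rotate r E (rotate E N (toℕ j)))        ∎))
      where open ≡-Reasoning
    ... | inj₂ (j-last , to-Y) =
      inj₂ (relabel-last j j-last , relabel-Y (cycles ⟨$⟩ʳ j) (trans (toℕ-cycles j) to-Y))

-- The group ℤ_m × ℤ_m for m = 2 ^ (k + 1), carried by Fin (m * m): the element with
-- coordinates (x , y) is the index m * y + x.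
module Torus (k m′ : ℕ) (m≡2^k+1 : suc m′ ≡ 2 ^ suc k) where

  m : ℕ
  m = suc m′

  2≤m : 2 ≤ m
  2≤m = subst (2 ≤_) (sym m≡2^k+1) (*-monoʳ-≤ 2 (m^n>0 2 k))

  Point : Set
  Point = Fin (m * m)

  -- Congruence modulo m, as a setoid so that chains of congruences can be written in
  -- equational style.
  infix 4 _≡ₘ_
  record _≡ₘ_ (x y : ℕ) : Set where
    constructor reduces
    field reduced : x % m ≡ y % m
  open _≡ₘ_ public

  ≡ₘ-setoid : Setoid 0ℓ 0ℓ
  ≡ₘ-setoid = record
    { Carrier = ℕ ; _≈_ = _≡ₘ_
    ; isEquivalence = record
      { refl = reduces refl
      ; sym = λ (reduces p) → reduces (sym p)
      ; trans = λ (reduces p) (reduces q) → reduces (trans p q) } }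

  module ≡ₘ-Reasoning = SetoidReasoning ≡ₘ-setoid
  open Setoid ≡ₘ-setoid public using ()
    renaming (refl to ≡ₘ-refl; sym to ≡ₘ-sym; trans to ≡ₘ-trans; reflexive to ≡⇒≡ₘ)

  +-congₘ : ∀ {a a′ b b′} → a ≡ₘ a′ → b ≡ₘ b′ → a + b ≡ₘ a′ + b′
  +-congₘ {a} {a′} {b} {b′} (reduces a≡a′) (reduces b≡b′) = reduces (begin
    (a + b) % m             ≡⟨ %-distribˡ-+ a b m ⟩
    (a % m + b % m) % m     ≡⟨ cong₂ (λ u v → (u + v) % m) a≡a′ b≡b′ ⟩
    (a′ % m + b′ % m) % m   ≡⟨ %-distribˡ-+ a′ b′ m ⟨
    (a′ + b′) % m           ∎)
    where open ≡-Reasoning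

  *-congˡₘ : ∀ c {b b′} → b ≡ₘ b′ → c * b ≡ₘ c * b′
  *-congˡₘ c {b} {b′} (reduces b≡b′) = reduces (begin
    (c * b) % m             ≡⟨ %-distribˡ-* c b m ⟩
    (c % m * (b % m)) % m   ≡⟨ cong (λ v → (c % m * v) % m) b≡b′ ⟩
    (c % m * (b′ % m)) % m  ≡⟨ %-distribˡ-* c b′ m ⟨
    (c * b′) % m            ∎)
    where open ≡-Reasoning

  ≡ₘ-by : ∀ {a b} q → a ≡ b + q * m → a ≡ₘ b
  ≡ₘ-by {b = b} q a≡b+qm = reduces (trans (cong (_% m) a≡b+qm) ([m+kn]%n≡m%n b q m))

  data Axis : Set where
    horizontal vertical : Axis

  coord : Axis → Point → ℕ
  coord horizontal g = toℕ (remainder {m} m g)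
  coord vertical   g = toℕ (quotient {m} m g)

  point : (Axis → ℕ) → Point
  point v = combine (v vertical mod m) (v horizontal mod m)

  toℕ-mod : ∀ x → toℕ (x mod m) ≡ x % m
  toℕ-mod x = toℕ-fromℕ< (m%n<n x m)

  coord-point : ∀ a v → coord a (point v) ≡ₘ v a
  coord-point a v = reduces (begin
    coord a (point v) % m    ≡⟨ cong (_% m) (coord-combine a) ⟩
    toℕ (v a mod m) % m      ≡⟨ cong (_% m) (toℕ-mod (v a)) ⟩
    v a % m % m              ≡⟨ m%n%n≡m%n (v a) m ⟩
    v a % m                  ∎)
    where
    open ≡-Reasoning
    split≡ : remQuot {m} m (point v) ≡ (v vertical mod m , v horizontal mod m)
    split≡ = remQuot-combine (v vertical mod m) (v horizontal mod m)
    coord-combine : ∀ a → coord a (point v) ≡ toℕ (v a mod m)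
    coord-combine horizontal = cong (λ (p : Fin m × Fin m) → toℕ (proj₂ p)) split≡
    coord-combine vertical   = cong (λ (p : Fin m × Fin m) → toℕ (proj₁ p)) split≡

  mod-cong : ∀ {x x′} → x ≡ₘ x′ → x mod m ≡ x′ mod m
  mod-cong {x} {x′} (reduces x≡x′) = toℕ-injective (trans (toℕ-mod x) (trans x≡x′ (sym (toℕ-mod x′))))

  point-cong : ∀ {v w} → (∀ a → v a ≡ₘ w a) → point v ≡ point w
  point-cong v≡w = cong₂ combine (mod-cong (v≡w vertical)) (mod-cong (v≡w horizontal))

  coord-η : ∀ g → point (λ a → coord a g) ≡ g
  coord-η g = begin
    combine (coord vertical g mod m) (coord horizontal g mod m)
      ≡⟨ cong₂ combine (reduce (quotient {m} m g)) (reduce (remainder {m} m g)) ⟩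
    uncurry combine (remQuot {m} m g)           ≡⟨ combine-remQuot {m} m g ⟩
    g                                           ∎
    where
    open ≡-Reasoning
    reduce : ∀ (i : Fin m) → toℕ i mod m ≡ i
    reduce i = toℕ-injective (trans (toℕ-mod (toℕ i)) (m<n⇒m%n≡m (toℕ<n i)))

  coords-≡ : ∀ {g h} → (∀ a → coord a g ≡ₘ coord a h) → g ≡ h
  coords-≡ {g} {h} g≡h = trans (sym (coord-η g)) (trans (point-cong g≡h) (coord-η h))

  infixl 6 _⊕_
  _⊕_ : Point → Point → Point
  g ⊕ h = point λ a → coord a g + coord a h

  ⊖_ : Point → Point
  ⊖ g = point λ a → m′ * coord a g

  𝟘 : Point
  𝟘 = point λ _ → 0

  coord-⊕ : ∀ a g h → coord a (g ⊕ h) ≡ₘ coord a g + coord a h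
  coord-⊕ a g h = coord-point a (λ b → coord b g + coord b h)

  coord-𝟘 : ∀ a → coord a 𝟘 ≡ₘ 0
  coord-𝟘 a = coord-point a (λ _ → 0)

  coord-⊖ : ∀ a g → coord a (⊖ g) ≡ₘ m′ * coord a g
  coord-⊖ a g = coord-point a (λ b → m′ * coord b g)

  ⊕-assoc : ∀ g h k → (g ⊕ h) ⊕ k ≡ g ⊕ (h ⊕ k)
  ⊕-assoc g h k = coords-≡ λ a → begin
    coord a ((g ⊕ h) ⊕ k)                ≈⟨ coord-⊕ a (g ⊕ h) k ⟩
    coord a (g ⊕ h) + coord a k          ≈⟨ +-congₘ (coord-⊕ a g h) ≡ₘ-refl ⟩
    coord a g + coord a h + coord a k    ≡⟨ +-assoc (coord a g) _ _ ⟩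
    coord a g + (coord a h + coord a k)  ≈⟨ +-congₘ ≡ₘ-refl (coord-⊕ a h k) ⟨
    coord a g + coord a (h ⊕ k)          ≈⟨ coord-⊕ a g (h ⊕ k) ⟨
    coord a (g ⊕ (h ⊕ k))                ∎
    where open ≡ₘ-Reasoning

  ⊕-comm : ∀ g h → g ⊕ h ≡ h ⊕ g
  ⊕-comm g h = coords-≡ λ a → ≡ₘ-trans (coord-⊕ a g h)
    (≡ₘ-trans (≡⇒≡ₘ (+-comm (coord a g) (coord a h))) (≡ₘ-sym (coord-⊕ a h g)))

  ⊕-identityˡ : ∀ g → 𝟘 ⊕ g ≡ g
  ⊕-identityˡ g = coords-≡ λ a → ≡ₘ-trans (coord-⊕ a 𝟘 g) (+-congₘ (coord-𝟘 a) ≡ₘ-refl)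

  -- m - 1 acts as -1.
  m′-is-minus-one : ∀ x → m′ * x + x ≡ 0 + x * m
  m′-is-minus-one x = trans (+-comm (m′ * x) x) (*-comm m x)

  ⊕-inverseˡ : ∀ g → ⊖ g ⊕ g ≡ 𝟘
  ⊕-inverseˡ g = coords-≡ λ a → begin
    coord a (⊖ g ⊕ g)          ≈⟨ coord-⊕ a (⊖ g) g ⟩
    coord a (⊖ g) + coord a g  ≈⟨ +-congₘ (coord-⊖ a g) ≡ₘ-refl ⟩
    m′ * coord a g + coord a g ≈⟨ ≡ₘ-by (coord a g) (m′-is-minus-one (coord a g)) ⟩
    0                          ≈⟨ coord-𝟘 a ⟨
    coord a 𝟘                  ∎
    where open ≡ₘ-Reasoning

  ⊕-isAbelianGroup : IsAbelianGroup _≡_ _⊕_ 𝟘 ⊖_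
  ⊕-isAbelianGroup = record
    { isGroup = record
      { isMonoid = record
        { isSemigroup = record
          { isMagma = record { isEquivalence = isEquivalence ; ∙-cong = cong₂ _⊕_ }
          ; assoc = ⊕-assoc }
        ; identity = ⊕-identityˡ , λ g → trans (⊕-comm g 𝟘) (⊕-identityˡ g) }
      ; inverse = ⊕-inverseˡ , λ g → trans (⊕-comm g (⊖ g)) (⊕-inverseˡ g)
      ; ⁻¹-cong = cong ⊖_ }
    ; comm = ⊕-comm }

  open ShiftFactors ⊕-isAbelianGroup using (_·_; HasOrder; _-_)

  dx dy : Point → ℕ
  dx = coord horizontal
  dy = coord vertical

  fibonacci-coords : Point → Axis → ℕ
  fibonacci-coords g horizontal = dy g
  fibonacci-coords g vertical   = dx g + dy g

  fibonacci : Point → Point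
  fibonacci g = point (fibonacci-coords g)

  coord-fibonacci : ∀ a g → coord a (fibonacci g) ≡ₘ fibonacci-coords g a
  coord-fibonacci a g = coord-point a (fibonacci-coords g)

  fibonacci-⊕ : ∀ g h → fibonacci (g ⊕ h) ≡ fibonacci g ⊕ fibonacci h
  fibonacci-⊕ g h = coords-≡ coordinatewise
    where
    open ≡ₘ-Reasoning
    coordinatewise : ∀ a → coord a (fibonacci (g ⊕ h)) ≡ₘ coord a (fibonacci g ⊕ fibonacci h)
    coordinatewise horizontal = begin
      coord horizontal (fibonacci (g ⊕ h))  ≈⟨ coord-fibonacci horizontal (g ⊕ h) ⟩
      dy (g ⊕ h)                            ≈⟨ coord-⊕ vertical g h ⟩
      dy g + dy h
        ≈⟨ +-congₘ (coord-fibonacci horizontal g) (coord-fibonacci horizontal h) ⟨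
      dx (fibonacci g) + dx (fibonacci h)   ≈⟨ coord-⊕ horizontal (fibonacci g) (fibonacci h) ⟨
      dx (fibonacci g ⊕ fibonacci h)        ∎
    coordinatewise vertical = begin
      coord vertical (fibonacci (g ⊕ h))    ≈⟨ coord-fibonacci vertical (g ⊕ h) ⟩
      dx (g ⊕ h) + dy (g ⊕ h)               ≈⟨ +-congₘ (coord-⊕ horizontal g h) (coord-⊕ vertical g h) ⟩
      (dx g + dx h) + (dy g + dy h)         ≡⟨ interchange (dx g) (dx h) (dy g) (dy h) ⟩
      (dx g + dy g) + (dx h + dy h)         ≈⟨ +-congₘ (coord-fibonacci vertical g) (coord-fibonacci vertical h) ⟨
      dy (fibonacci g) + dy (fibonacci h)   ≈⟨ coord-⊕ vertical (fibonacci g) (fibonacci h) ⟨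
      dy (fibonacci g ⊕ fibonacci h)        ∎

  fibonacci² : ∀ g → fibonacci (fibonacci g) ≡ fibonacci g ⊕ g
  fibonacci² g = coords-≡ coordinatewise
    where
    open ≡ₘ-Reasoning
    coordinatewise : ∀ a → coord a (fibonacci (fibonacci g)) ≡ₘ coord a (fibonacci g ⊕ g)
    coordinatewise horizontal = begin
      dx (fibonacci (fibonacci g))  ≈⟨ coord-fibonacci horizontal (fibonacci g) ⟩
      dy (fibonacci g)              ≈⟨ coord-fibonacci vertical g ⟩
      dx g + dy g                   ≡⟨ +-comm (dx g) (dy g) ⟩
      dy g + dx g                   ≈⟨ +-congₘ (coord-fibonacci horizontal g) ≡ₘ-refl ⟨
      dx (fibonacci g) + dx g       ≈⟨ coord-⊕ horizontal (fibonacci g) g ⟨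
      dx (fibonacci g ⊕ g)          ∎
    coordinatewise vertical = begin
      dy (fibonacci (fibonacci g))  ≈⟨ coord-fibonacci vertical (fibonacci g) ⟩
      dx (fibonacci g) + dy (fibonacci g) ≈⟨ +-congₘ (coord-fibonacci horizontal g) (coord-fibonacci vertical g) ⟩
      dy g + (dx g + dy g)          ≡⟨ +-comm (dy g) (dx g + dy g) ⟩
      dx g + dy g + dy g            ≈⟨ +-congₘ (coord-fibonacci vertical g) ≡ₘ-refl ⟨
      dy (fibonacci g) + dy g       ≈⟨ coord-⊕ vertical (fibonacci g) g ⟨
      dy (fibonacci g ⊕ g)          ∎

  coord-· : ∀ a t g → coord a (t · g) ≡ₘ t * coord a g
  coord-· a zero    g = coord-𝟘 a
  coord-· a (suc t) g = ≡ₘ-trans (coord-⊕ a g (t · g)) (+-congₘ ≡ₘ-refl (coord-· a t g))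

  coord-- : ∀ a g h → coord a (g - h) ≡ₘ coord a g + m′ * coord a h
  coord-- a g h = ≡ₘ-trans (coord-⊕ a g (⊖ h)) (+-congₘ ≡ₘ-refl (coord-⊖ a h))

  parity-m : parity m ≡ 0ℙ
  parity-m = trans (cong parity m≡2^k+1) (2∣⇒parity≡0ℙ (divides (2 ^ k) (*-comm 2 (2 ^ k))))

  parity-m′ : parity m′ ≡ 1ℙ
  parity-m′ = odd-before-even m′ parity-m

  distinct-parities : ∀ {p q} → p ≢ q → p ℙ+ q ≡ 1ℙ
  distinct-parities {0ℙ} {0ℙ} p≢q = contradiction refl p≢q
  distinct-parities {0ℙ} {1ℙ} _   = refl
  distinct-parities {1ℙ} {0ℙ} _   = refl
  distinct-parities {1ℙ} {1ℙ} p≢q = contradiction refl p≢q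

  Different : Point → Point → Set
  Different g h = Σ Axis λ a → parity (coord a g) ≢ parity (coord a h)

  -- Then their difference has an odd coordinate, hence order m.
  different⇒order : ∀ {g h} → Different g h → HasOrder m (g - h)
  different⇒order {g} {h} (a , differ) = m·d≡𝟘 , no-smaller
    where
    d : Point
    d = g - h
    m·d≡𝟘 : m · d ≡ 𝟘
    m·d≡𝟘 = coords-≡ λ b → ≡ₘ-trans (coord-· b m d)
               (≡ₘ-trans (≡ₘ-by (coord b d) (*-comm m (coord b d))) (≡ₘ-sym (coord-𝟘 b)))
    o : ℕ
    o = coord a g + m′ * coord a h
    o-odd : parity o ≡ 1ℙ
    o-odd = begin
      parity o                                          ≡⟨ +-homo-+ (coord a g) (m′ * coord a h) ⟩
      parity (coord a g) ℙ+ parity (m′ * coord a h)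
        ≡⟨ cong (parity (coord a g) ℙ+_) (*-homo-* m′ (coord a h)) ⟩
      parity (coord a g) ℙ+ (parity m′ ℙ* parity (coord a h))
        ≡⟨ cong (λ p → parity (coord a g) ℙ+ (p ℙ* parity (coord a h))) parity-m′ ⟩
      parity (coord a g) ℙ+ parity (coord a h)          ≡⟨ distinct-parities differ ⟩
      1ℙ                                                ∎
      where open ≡-Reasoning
    no-smaller : ∀ t → 0 < t → t < m → t · d ≢ 𝟘
    no-smaller t 0<t t<m t·d≡𝟘 = <⇒≱ t<m (∣⇒≤ {{>-nonZero 0<t}} m∣t)
      where
      t*o≡ₘ0 : t * o ≡ₘ 0
      t*o≡ₘ0 = begin
        t * o            ≈⟨ *-congˡₘ t (coord-- a g h) ⟨
        t * coord a d    ≈⟨ coord-· a t d ⟨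
        coord a (t · d)  ≡⟨ cong (coord a) t·d≡𝟘 ⟩
        coord a 𝟘        ≈⟨ coord-𝟘 a ⟩
        0                ∎
        where open ≡ₘ-Reasoning
      m∣t : m ∣ t
      m∣t = subst (_∣ t) (sym m≡2^k+1) (2^k∣t*odd⇒2^k∣t (suc k) t o-odd
              (subst (_∣ t * o) m≡2^k+1 (m%n≡0⇒n∣m (t * o) m (reduced t*o≡ₘ0))))

  toℕ-coords : ∀ g → toℕ g ≡ m * dy g + dx g
  toℕ-coords g = trans (cong toℕ (sym (combine-remQuot {m} m g))) (toℕ-combine (quotient {m} m g) (remainder {m} m g))

  dy-of-index : ∀ {g x y} → x < m → y < m → toℕ g ≡ m * y + x → dy g ≡ y
  dy-of-index {g} x<m y<m index = begin
    dy g                                              ≡⟨ cong dy g≡ ⟩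
    toℕ (proj₁ (remQuot {m} m (combine (fromℕ< y<m) (fromℕ< x<m))))
      ≡⟨ cong (λ (p : Fin m × Fin m) → toℕ (proj₁ p)) (remQuot-combine (fromℕ< y<m) (fromℕ< x<m)) ⟩
    toℕ (fromℕ< y<m)                                  ≡⟨ toℕ-fromℕ< y<m ⟩
    _                                                 ∎
    where
    open ≡-Reasoning
    g≡ : g ≡ combine (fromℕ< y<m) (fromℕ< x<m)
    g≡ = toℕ-injective (trans index (sym (trans (toℕ-combine (fromℕ< y<m) (fromℕ< x<m))
                         (cong₂ (λ u v → m * u + v) (toℕ-fromℕ< y<m) (toℕ-fromℕ< x<m)))))

  -- Since m is even, the first coordinate has the parity of the index.
  parity-dx : ∀ g → parity (dx g) ≡ parity (toℕ g)
  parity-dx g = sym (begin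
    parity (toℕ g)                          ≡⟨ cong parity (toℕ-coords g) ⟩
    parity (m * dy g + dx g)                ≡⟨ +-homo-+ (m * dy g) (dx g) ⟩
    parity (m * dy g) ℙ+ parity (dx g)      ≡⟨ cong (_ℙ+ parity (dx g)) (*-homo-* m (dy g)) ⟩
    parity m ℙ* parity (dy g) ℙ+ parity (dx g)
                                            ≡⟨ cong (λ p → p ℙ* parity (dy g) ℙ+ parity (dx g)) parity-m ⟩
    parity (dx g)                           ∎)
    where open ≡-Reasoning

  different-by-parity : ∀ {g h} → parity (toℕ g) ≢ parity (toℕ h) → Different g h
  different-by-parity {g} {h} differ = horizontal , λ same → differ (trans (sym (parity-dx g)) (trans same (parity-dx h)))

  -- The last index m * m - 1 = (m - 1 , m - 1) and the index 1 = (1 , 0) differ vertically.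
  different-corner : ∀ {g h} → toℕ g ≡ m′ + m′ * m → toℕ h ≡ 1 → Different g h
  different-corner {g} {h} g-last h-one = vertical , λ same →
    p≢p⁻¹ 0ℙ (trans (sym (cong parity dy-h)) (trans (sym same) (trans (cong parity dy-g) parity-m′)))
    where
    dy-g : dy g ≡ m′
    dy-g = dy-of-index (n<1+n m′) (n<1+n m′)
             (trans g-last (trans (+-comm m′ (m′ * m)) (cong (_+ m′) (*-comm m′ m))))
    dy-h : dy h ≡ 0
    dy-h = dy-of-index 2≤m (s≤s z≤n) (trans h-one (sym (cong (_+ 1) (*-zeroʳ m))))

  Y : ℕ
  Y = m * m ∸ 3

  m*m≡3+Y : m * m ≡ 3 + Y
  m*m≡3+Y = sym (m+[n∸m]≡n (≤-trans (n≤1+n 3) (*-mono-≤ 2≤m 2≤m)))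

  2+Y≡last : 2 + Y ≡ m′ + m′ * m
  2+Y≡last = suc-injective (sym m*m≡3+Y)

  Y-odd : parity Y ≡ 1ℙ
  Y-odd = odd-before-even Y (begin
    parity (3 + Y)         ≡⟨ cong parity m*m≡3+Y ⟨
    parity (m * m)         ≡⟨ *-homo-* m m ⟩
    parity m ℙ* parity m   ≡⟨ cong (_ℙ* parity m) parity-m ⟩
    0ℙ                     ∎)
    where open ≡-Reasoning

  decomposition : ∀ r → r ≤ m * m → r ≢ m′ + m′ * m → CycleDecomposition (m * m) r (3 * m)
  decomposition r r≤N r≢last =
    golden-decomposition relabel cycles r m cycles-fixes λ j r≤j → different⇒order (different (separated j r≤j))
    where
    open ShiftFactors.Golden ⊕-isAbelianGroup fibonacci fibonacci-⊕ fibonacci²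
    open Indices (m * m) Y m*m≡3+Y Y-odd
    open Cycles r r≤N (λ r≡2+Y → r≢last (trans r≡2+Y 2+Y≡last))
    different : ∀ {g h} → Separated g h → Different g h
    different (inj₁ parities)       = different-by-parity parities
    different (inj₂ (j-last , to-1)) = different-corner (trans j-last 2+Y≡last) to-1

4^n≡2^n*2^n : ∀ n → 4 ^ n ≡ 2 ^ n * 2 ^ n
4^n≡2^n*2^n n = trans (^-*-assoc 2 2 n) (trans (cong (λ e → 2 ^ (n + e)) (+-identityʳ n)) (^-distribˡ-+-* 2 n n))

lemma3p4 : (k : ℕ) → 0 < k → (r : ℕ) → r ≤ 4 ^ k → r ≢ 4 ^ k ∸ 1 → Decomposition k r
lemma3p4 (suc k) _ r r≤4^k r≢4^k-1 =
  subst₂ (λ n ℓ → CycleDecomposition n r ℓ) m*m≡4^k (cong (3 *_) m≡2^k)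
    (Torus.decomposition k m′ m≡2^k r
      (subst (r ≤_) (sym m*m≡4^k) r≤4^k)
      (subst (λ n → r ≢ n ∸ 1) (sym m*m≡4^k) r≢4^k-1))
  where
  instance
    2^k≢0 : NonZero (2 ^ suc k)
    2^k≢0 = m^n≢0 2 (suc k)
  m′ : ℕ
  m′ = pred (2 ^ suc k)
  m≡2^k : suc m′ ≡ 2 ^ suc k
  m≡2^k = suc-pred (2 ^ suc k)
  m*m≡4^k : suc m′ * suc m′ ≡ 4 ^ suc k
  m*m≡4^k = trans (cong₂ _*_ m≡2^k m≡2^k) (sym (4^n≡2^n*2^n (suc k)))
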